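{- Let $P$ be a functional Pure Type System containing at least one sort $s_0$. For all terms $A,B$ of $P$ such that $\|A\|$ and $\|B\|$ are defined, and all terms $C,D$ of $\lambda\Pi_P$: (1) if $A\equiv_\beta B$ then $\|A\|\equiv\|B\|$; (2) if $C\equiv D$ then $C^*\equiv_\beta D^*$; (3) if $\|A\|\equiv\|B\|$ then $A\equiv_\beta B$.
   Context: A Pure Type System $P=\langle S,A,R\rangle$ has sorts $S$, axioms $A\subseteq S\times S$, rules $R\subseteq S\times S\times S$, usual PTS typing; functional means axioms and rules are functional relations in their first one, resp. two, components. $\equiv_\beta$ is $\beta$-equivalence. $\lambda\Pi_P$-terms: $t::=x\mid Type\mid Kind\mid \Pi x:t~t\mid\lambda x:t~t\mid t~t$, with constants $U_s,\varepsilon_s$ ($s\in S$), $\dot{s_1}$ ($\langle s_1,s_2\rangle\in A$), $\dot\Pi_{\langle s_1,s_2,s_3\rangle}$ ($\langle s_1,s_2,s_3\rangle\in R$). $\equiv$ is the congruence generated by $\beta$ and the rewrite rules $\varepsilon_{s_2}~\dot{s_1}\longrightarrow U_{s_1}$ ($\langle s_1,s_2\rangle\in A$) and $\varepsilon_{s_3}(\dot\Pi_{\langle s_1,s_2,s_3\rangle}~X~Y)\longrightarrow \Pi x:(\varepsilon_{s_1}~X)~(\varepsilon_{s_2}~(Y~x))$ ($\langle s_1,s_2,s_3\rangle\in R$). Translation of $t$ well-typed in $P$: $|x|=x$; $|s|=\dot s$; $|\Pi x:A~B|=\dot\Pi_{\langle s_1,s_2,s_3\rangle}~|A|~(\lambda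 x:(\varepsilon_{s_1}~|A|)~|B|)$ with $s_1,s_2,s_3$ the types of $A$, $B$, $\Pi x:A~B$; $|\lambda x:A~t|=\lambda x:(\varepsilon_s~|A|)~|t|$ with $s$ the type of $A$; $|t~u|=|t|~|u|$. For $A$ of type a sort $s$, $\|A\|=\varepsilon_s~|A|$; for a non-typable sort $s'$, $\|s'\|=U_{s'}$. Back translation: $x^*=x$; $Type^*=Kind^*=s_0$; $\dot s^*=s$; $U_s^*=s$; $(\Pi x:A~B)^*=\Pi x:A^*~B^*$; $(\lambda x:A~t)^*=\lambda x:A^*~t^*$; $(\dot\Pi_{\langle s_1,s_2,s_3\rangle}~A~B)^*=\Pi x:A^*~(B^*~x)$; $(\varepsilon_s~u)^*=u^*$; $(t~u)^*=t^*~u^*$ otherwise. -}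

module Defs where

open import Data.Nat using (ℕ; zero; suc)
open import Data.Fin using (Fin; zero; suc)
open import Data.Product using (Σ; _×_; _,_)
open import Data.Sum using (_⊎_)
open import Relation.Nullary using (¬_)
open import Relation.Binary.PropositionalEquality using (_≡_)
open import Relation.Binary.Construct.Closure.Equivalence using (EqClosure)

record PTS : Set₁ where
  field
    Sort : Set
    Ax   : Sort → Sort → Set
    Rl   : Sort → Sort → Sort → Set

record IsFunctional (P : PTS) : Set where
  open PTS P
  field
    ax-functional : ∀ {s₁ s₂ s₂'} → Ax s₁ s₂ → Ax s₁ s₂' → s₂ ≡ s₂'
    rl-functional : ∀ {s₁ s₂ s₃ s₃'} → Rl s₁ s₂ s₃ → Rl s₁ s₂ s₃' → s₃ ≡ s₃'

data Tm (C : Set) (n : ℕ) : Set where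
  var   : Fin n → Tm C n
  const : C → Tm C n
  pi    : Tm C n → Tm C (suc n) → Tm C n
  lam   : Tm C n → Tm C (suc n) → Tm C n
  app   : Tm C n → Tm C n → Tm C n

module _ {C : Set} where

  ext : ∀ {m n} → (Fin m → Fin n) → Fin (suc m) → Fin (suc n)
  ext ρ zero    = zero
  ext ρ (suc i) = suc (ρ i)

  ren : ∀ {m n} → (Fin m → Fin n) → Tm C m → Tm C n
  ren ρ (var i)   = var (ρ i)
  ren ρ (const c) = const c
  ren ρ (pi A B)  = pi (ren ρ A) (ren (ext ρ) B)
  ren ρ (lam A t) = lam (ren ρ A) (ren (ext ρ) t)
  ren ρ (app t u) = app (ren ρ t) (ren ρ u)

  wk : ∀ {n} → Tm C n → Tm C (suc n)
  wk = ren suc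

  exts : ∀ {m n} → (Fin m → Tm C n) → Fin (suc m) → Tm C (suc n)
  exts σ zero    = var zero
  exts σ (suc i) = wk (σ i)

  sub : ∀ {m n} → (Fin m → Tm C n) → Tm C m → Tm C n
  sub σ (var i)   = σ i
  sub σ (const c) = const c
  sub σ (pi A B)  = pi (sub σ A) (sub (exts σ) B)
  sub σ (lam A t) = lam (sub σ A) (sub (exts σ) t)
  sub σ (app t u) = app (sub σ t) (sub σ u)

  _[_] : ∀ {n} → Tm C (suc n) → Tm C n → Tm C n
  t [ u ] = sub σ t
    where
      σ : Fin (suc _) → Tm C _
      σ zero    = u
      σ (suc i) = var i

  data Beta {n : ℕ} : Tm C n → Tm C n → Set where
    beta : ∀ (A : Tm C n) t u → Beta (app (lam A t) u) (t [ u ])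

  data Comp (R : ∀ {n} → Tm C n → Tm C n → Set) {n : ℕ} : Tm C n → Tm C n → Set where
    root : ∀ {t u} → R t u → Comp R t u
    piˡ  : ∀ {A A' B} → Comp R A A' → Comp R (pi A B) (pi A' B)
    piʳ  : ∀ {A B B'} → Comp R B B' → Comp R (pi A B) (pi A B')
    lamˡ : ∀ {A A' t} → Comp R A A' → Comp R (lam A t) (lam A' t)
    lamʳ : ∀ {A t t'} → Comp R t t' → Comp R (lam A t) (lam A t')
    appˡ : ∀ {t t' u} → Comp R t t' → Comp R (app t u) (app t' u)
    appʳ : ∀ {t u u'} → Comp R u u' → Comp R (app t u) (app t u')

  _⟶β_ : ∀ {n} → Tm C n → Tm C n → Set
  _⟶β_ = Comp Beta

  _≡β_ : ∀ {n} → Tm C n → Tm C n → Set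
  _≡β_ = EqClosure _⟶β_

  infix 4 _≡β_

PTm : PTS → ℕ → Set
PTm P = Tm (PTS.Sort P)

data Ctx (P : PTS) : ℕ → Set where
  []  : Ctx P zero
  _▸_ : ∀ {n} → Ctx P n → PTm P n → Ctx P (suc n)

module _ {P : PTS} where
  open PTS P

  infix 3 _⊢_∶_
  data _⊢_∶_ : ∀ {n} → Ctx P n → PTm P n → PTm P n → Set where
    axiom : ∀ {s₁ s₂} → Ax s₁ s₂ → [] ⊢ const s₁ ∶ const s₂
    start : ∀ {n} {Γ : Ctx P n} {A s} →
            Γ ⊢ A ∶ const s → (Γ ▸ A) ⊢ var zero ∶ wk A
    weakening : ∀ {n} {Γ : Ctx P n} {A B C s} →
            Γ ⊢ A ∶ B → Γ ⊢ C ∶ const s → (Γ ▸ C) ⊢ wk A ∶ wk B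
    product : ∀ {n} {Γ : Ctx P n} {A B s₁ s₂ s₃} → Rl s₁ s₂ s₃ →
            Γ ⊢ A ∶ const s₁ → (Γ ▸ A) ⊢ B ∶ const s₂ →
            Γ ⊢ pi A B ∶ const s₃
    application : ∀ {n} {Γ : Ctx P n} {F A B a} →
            Γ ⊢ F ∶ pi A B → Γ ⊢ a ∶ A → Γ ⊢ app F a ∶ B [ a ]
    abstraction : ∀ {n} {Γ : Ctx P n} {A B b s} →
            (Γ ▸ A) ⊢ b ∶ B → Γ ⊢ pi A B ∶ const s →
            Γ ⊢ lam A b ∶ pi A B
    conversion : ∀ {n} {Γ : Ctx P n} {a B B' s} →
            Γ ⊢ a ∶ B → Γ ⊢ B' ∶ const s → B ≡β B' → Γ ⊢ a ∶ B'

data LConst (P : PTS) : Set where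
  Type Kind : LConst P
  U ε       : PTS.Sort P → LConst P
  dot       : (s₁ s₂ : PTS.Sort P) → .(PTS.Ax P s₁ s₂) → LConst P
  Πdot      : (s₁ s₂ s₃ : PTS.Sort P) → .(PTS.Rl P s₁ s₂ s₃) → LConst P

LTm : PTS → ℕ → Set
LTm P = Tm (LConst P)

module _ {P : PTS} where
  open PTS P

  data Rw {n : ℕ} : LTm P n → LTm P n → Set where
    rw-ax : ∀ {s₁ s₂} (a : Ax s₁ s₂) →
      Rw (app (const (ε s₂)) (const (dot s₁ s₂ a))) (const (U s₁))
    rw-pi : ∀ {s₁ s₂ s₃} (r : Rl s₁ s₂ s₃) (X Y : LTm P n) →
      Rw (app (const (ε s₃)) (app (app (const (Πdot s₁ s₂ s₃ r)) X) Y))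
         (pi (app (const (ε s₁)) X)
             (app (const (ε s₂)) (app (wk Y) (var zero))))

  data BetaRw {n : ℕ} (t u : LTm P n) : Set where
    by-β  : Beta t u → BetaRw t u
    by-rw : Rw t u → BetaRw t u

  _⟶λΠ_ : ∀ {n} → LTm P n → LTm P n → Set
  _⟶λΠ_ = Comp BetaRw

  _≡λΠ_ : ∀ {n} → LTm P n → LTm P n → Set
  _≡λΠ_ = EqClosure _⟶λΠ_

  infix 4 _≡λΠ_

  -- Translation |t| (as a relation Tr Γ t |t|, sorts read off typing)

  data Tr {n : ℕ} (Γ : Ctx P n) : PTm P n → LTm P n → Set where
    tr-var  : ∀ i → Tr Γ (var i) (var i)
    tr-sort : ∀ {s₁ s₂} (a : Ax s₁ s₂) → Tr Γ (const s₁) (const (dot s₁ s₂ a))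
    tr-pi   : ∀ {A B a b s₁ s₂ s₃} (r : Rl s₁ s₂ s₃) →
              Γ ⊢ A ∶ const s₁ → (Γ ▸ A) ⊢ B ∶ const s₂ →
              Γ ⊢ pi A B ∶ const s₃ →
              Tr Γ A a → Tr (Γ ▸ A) B b →
              Tr Γ (pi A B)
                 (app (app (const (Πdot s₁ s₂ s₃ r)) a)
                      (lam (app (const (ε s₁)) a) b))
    tr-lam  : ∀ {A t a u s} →
              Γ ⊢ A ∶ const s → Tr Γ A a → Tr (Γ ▸ A) t u →
              Tr Γ (lam A t) (lam (app (const (ε s)) a) u)
    tr-app  : ∀ {t u a b} → Tr Γ t a → Tr Γ u b → Tr Γ (app t u) (app a b)

  NonTypable : Sort → Set
  NonTypable s = ∀ {m} (Δ : Ctx P m) (T : PTm P m) → ¬ (Δ ⊢ const s ∶ T)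

  -- ‖A‖ (as a relation Norm Γ A ‖A‖; "‖A‖ is defined" = it has a witness)
  data Norm {n : ℕ} (Γ : Ctx P n) : PTm P n → LTm P n → Set where
    norm-typed : ∀ {A a s} → Γ ⊢ A ∶ const s → Tr Γ A a →
                 Norm Γ A (app (const (ε s)) a)
    norm-top   : ∀ {s} → NonTypable s → Norm Γ (const s) (const (U s))

  module _ (s₀ : Sort) where
    backConst : ∀ {n} → LConst P → PTm P n
    backConst Type             = const s₀
    backConst Kind             = const s₀
    backConst (U s)            = const s
    backConst (dot s₁ _ _)     = const s₁
    -- unapplied constants (not covered by the paper's clauses):
    -- ε_s* = λx:s₀. x ,  Π̇* = λX:s₀. λY:s₀. Π x:X (Y x)
    backConst (ε s)            = lam (const s₀) (var zero)
    backConst (Πdot _ _ _ _)   =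
      lam (const s₀) (lam (const s₀) (pi (var (suc zero)) (app (var (suc zero)) (var zero))))

    mutual
      back : ∀ {n} → LTm P n → PTm P n
      back (var i)   = var i
      back (const c) = backConst c
      back (pi A B)  = pi (back A) (back B)
      back (lam A t) = lam (back A) (back t)
      back (app t u) = backApp t u

      backApp : ∀ {n} → LTm P n → LTm P n → PTm P n
      backApp (const (ε s)) u = back u
      backApp (app (const (Πdot _ _ _ _)) A) B =
        pi (back A) (app (wk (back B)) (var zero))
      backApp t u = app (back t) (back u)

{-# OPTIONS --safe #-}
-- (1) By Church–Rosser, β-equivalent A and B have a common reduct C. Subject
-- reduction keeps both reductions well typed, and every β-step of a well-typed
-- term is simulated by λΠ-steps of its translation; as types, hence the sorts
-- annotating a translation, are unique in a functional PTS, ‖A‖ and ‖B‖ both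
-- reduce to ‖C‖. A non-typable sort is never β-equivalent to a typable term,
-- since the term would reduce to the sort and subject reduction would type it.
-- (2) The back translation maps β-steps and both rewrite rules to
-- β-conversions, because unapplied ε and Π̇ are sent to λ-terms whose
-- β-reducts are the special clauses for applied ε and Π̇.
-- (3) ‖A‖* ≡β A, so (3) follows from (2).
module Submission where

open import Defs
open import Data.Nat using (ℕ; zero; suc)
open import Data.Fin using (Fin; zero; suc)
open import Data.Product using (Σ; _×_; _,_; proj₁; proj₂)
open import Data.Sum using (_⊎_; inj₁; inj₂)
open import Data.Empty using (⊥-elim)
open import Data.Unit using (⊤; tt)
open import Function using (_∘_)
open import Relation.Binary.PropositionalEquality hiding ([_])
open import Relation.Binary.Construct.Closure.ReflexiveTransitive using (Star; ε; _◅_; _◅◅_)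
open import Relation.Binary.Construct.Closure.Symmetric using (fwd; bwd)
import Relation.Binary.Construct.Closure.ReflexiveTransitive as Star
import Relation.Binary.Construct.Closure.Equivalence as EqClosure
import Relation.Binary.Reasoning.Setoid as SetoidReasoning

ext-independent : ∀ {C D : Set} {m n} (ρ : Fin m → Fin n) → ∀ i → ext {C} ρ i ≡ ext {D} ρ i
ext-independent ρ zero    = refl
ext-independent ρ (suc i) = refl

module Substitution {C : Set} where

  Ren : ℕ → ℕ → Set
  Ren m n = Fin m → Fin n

  Sub : ℕ → ℕ → Set
  Sub m n = Fin m → Tm C n

  ext-cong : ∀ {m n} {ρ ρ' : Ren m n} → (∀ i → ρ i ≡ ρ' i) → ∀ i → ext {C} ρ i ≡ ext {C} ρ' i
  ext-cong h zero    = refl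
  ext-cong h (suc i) = cong suc (h i)

  ren-cong : ∀ {m n} {ρ ρ' : Ren m n} → (∀ i → ρ i ≡ ρ' i) → (t : Tm C m) → ren ρ t ≡ ren ρ' t
  ren-cong h (var i)   = cong var (h i)
  ren-cong h (const c) = refl
  ren-cong h (pi A B)  = cong₂ pi (ren-cong h A) (ren-cong (ext-cong h) B)
  ren-cong h (lam A t) = cong₂ lam (ren-cong h A) (ren-cong (ext-cong h) t)
  ren-cong h (app t u) = cong₂ app (ren-cong h t) (ren-cong h u)

  exts-cong : ∀ {m n} {σ σ' : Sub m n} → (∀ i → σ i ≡ σ' i) → ∀ i → exts σ i ≡ exts σ' i
  exts-cong h zero    = refl
  exts-cong h (suc i) = cong wk (h i)

  sub-cong : ∀ {m n} {σ σ' : Sub m n} → (∀ i → σ i ≡ σ' i) → (t : Tm C m) → sub σ t ≡ sub σ' t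
  sub-cong h (var i)   = h i
  sub-cong h (const c) = refl
  sub-cong h (pi A B)  = cong₂ pi (sub-cong h A) (sub-cong (exts-cong h) B)
  sub-cong h (lam A t) = cong₂ lam (sub-cong h A) (sub-cong (exts-cong h) t)
  sub-cong h (app t u) = cong₂ app (sub-cong h t) (sub-cong h u)

  ren-ren : ∀ {l m n} (ρ : Ren m n) (ρ' : Ren l m) (t : Tm C l) → ren ρ (ren ρ' t) ≡ ren (ρ ∘ ρ') t
  ren-ren ρ ρ' (var i)   = refl
  ren-ren ρ ρ' (const c) = refl
  ren-ren ρ ρ' (pi A B)  = cong₂ pi (ren-ren ρ ρ' A)
    (trans (ren-ren (ext {C} ρ) (ext {C} ρ') B) (ren-cong (λ { zero → refl ; (suc i) → refl }) B))
  ren-ren ρ ρ' (lam A t) = cong₂ lam (ren-ren ρ ρ' A)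
    (trans (ren-ren (ext {C} ρ) (ext {C} ρ') t) (ren-cong (λ { zero → refl ; (suc i) → refl }) t))
  ren-ren ρ ρ' (app t u) = cong₂ app (ren-ren ρ ρ' t) (ren-ren ρ ρ' u)

  sub-ren : ∀ {l m n} (σ : Sub m n) (ρ : Ren l m) (t : Tm C l) → sub σ (ren ρ t) ≡ sub (σ ∘ ρ) t
  sub-ren σ ρ (var i)   = refl
  sub-ren σ ρ (const c) = refl
  sub-ren σ ρ (pi A B)  = cong₂ pi (sub-ren σ ρ A)
    (trans (sub-ren (exts σ) (ext {C} ρ) B) (sub-cong (λ { zero → refl ; (suc i) → refl }) B))
  sub-ren σ ρ (lam A t) = cong₂ lam (sub-ren σ ρ A)
    (trans (sub-ren (exts σ) (ext {C} ρ) t) (sub-cong (λ { zero → refl ; (suc i) → refl }) t))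
  sub-ren σ ρ (app t u) = cong₂ app (sub-ren σ ρ t) (sub-ren σ ρ u)

  ren-ext-wk : ∀ {m n} (ρ : Ren m n) (t : Tm C m) → ren (ext {C} ρ) (wk t) ≡ wk (ren ρ t)
  ren-ext-wk ρ t = trans (ren-ren (ext {C} ρ) suc t) (sym (ren-ren suc ρ t))

  ren-ext-exts : ∀ {l m n} (ρ : Ren m n) (σ : Sub l m) → ∀ i → ren (ext {C} ρ) (exts σ i) ≡ exts (ren ρ ∘ σ) i
  ren-ext-exts ρ σ zero    = refl
  ren-ext-exts ρ σ (suc i) = ren-ext-wk ρ (σ i)

  ren-sub : ∀ {l m n} (ρ : Ren m n) (σ : Sub l m) (t : Tm C l) → ren ρ (sub σ t) ≡ sub (ren ρ ∘ σ) t
  ren-sub ρ σ (var i)   = refl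
  ren-sub ρ σ (const c) = refl
  ren-sub ρ σ (pi A B)  = cong₂ pi (ren-sub ρ σ A)
    (trans (ren-sub (ext {C} ρ) (exts σ) B) (sub-cong (ren-ext-exts ρ σ) B))
  ren-sub ρ σ (lam A t) = cong₂ lam (ren-sub ρ σ A)
    (trans (ren-sub (ext {C} ρ) (exts σ) t) (sub-cong (ren-ext-exts ρ σ) t))
  ren-sub ρ σ (app t u) = cong₂ app (ren-sub ρ σ t) (ren-sub ρ σ u)

  sub-exts-wk : ∀ {m n} (σ : Sub m n) (t : Tm C m) → sub (exts σ) (wk t) ≡ wk (sub σ t)
  sub-exts-wk σ t = trans (sub-ren (exts σ) suc t) (sym (ren-sub suc σ t))

  sub-exts-exts : ∀ {l m n} (τ : Sub m n) (σ : Sub l m) → ∀ i → sub (exts τ) (exts σ i) ≡ exts (sub τ ∘ σ) i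
  sub-exts-exts τ σ zero    = refl
  sub-exts-exts τ σ (suc i) = sub-exts-wk τ (σ i)

  sub-sub : ∀ {l m n} (τ : Sub m n) (σ : Sub l m) (t : Tm C l) → sub τ (sub σ t) ≡ sub (sub τ ∘ σ) t
  sub-sub τ σ (var i)   = refl
  sub-sub τ σ (const c) = refl
  sub-sub τ σ (pi A B)  = cong₂ pi (sub-sub τ σ A)
    (trans (sub-sub (exts τ) (exts σ) B) (sub-cong (sub-exts-exts τ σ) B))
  sub-sub τ σ (lam A t) = cong₂ lam (sub-sub τ σ A)
    (trans (sub-sub (exts τ) (exts σ) t) (sub-cong (sub-exts-exts τ σ) t))
  sub-sub τ σ (app t u) = cong₂ app (sub-sub τ σ t) (sub-sub τ σ u)

  ren≡sub-var : ∀ {m n} (ρ : Ren m n) (t : Tm C m) → ren ρ t ≡ sub (var ∘ ρ) t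
  ren≡sub-var ρ (var i)   = refl
  ren≡sub-var ρ (const c) = refl
  ren≡sub-var ρ (pi A B)  = cong₂ pi (ren≡sub-var ρ A)
    (trans (ren≡sub-var (ext {C} ρ) B) (sub-cong (λ { zero → refl ; (suc i) → refl }) B))
  ren≡sub-var ρ (lam A t) = cong₂ lam (ren≡sub-var ρ A)
    (trans (ren≡sub-var (ext {C} ρ) t) (sub-cong (λ { zero → refl ; (suc i) → refl }) t))
  ren≡sub-var ρ (app t u) = cong₂ app (ren≡sub-var ρ t) (ren≡sub-var ρ u)

  sub-var : ∀ {n} (t : Tm C n) → sub var t ≡ t
  sub-var (var i)   = refl
  sub-var (const c) = refl
  sub-var (pi A B)  = cong₂ pi (sub-var A) (trans (sub-cong (λ { zero → refl ; (suc i) → refl }) B) (sub-var B))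
  sub-var (lam A t) = cong₂ lam (sub-var A) (trans (sub-cong (λ { zero → refl ; (suc i) → refl }) t) (sub-var t))
  sub-var (app t u) = cong₂ app (sub-var t) (sub-var u)

  sub₀ : ∀ {n} → Tm C n → Sub (suc n) n
  sub₀ u zero    = u
  sub₀ u (suc i) = var i

  []≡sub₀ : ∀ {n} (t : Tm C (suc n)) (u : Tm C n) → t [ u ] ≡ sub (sub₀ u) t
  []≡sub₀ t u = sub-cong (λ { zero → refl ; (suc i) → refl }) t

  sub₀-wk : ∀ {n} (u t : Tm C n) → sub (sub₀ u) (wk t) ≡ t
  sub₀-wk u t = trans (sub-ren (sub₀ u) suc t) (sub-var t)

  sub-[] : ∀ {m n} (σ : Sub m n) (t : Tm C (suc m)) (u : Tm C m) →
           sub σ (t [ u ]) ≡ sub (exts σ) t [ sub σ u ]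
  sub-[] σ t u = begin
    sub σ (t [ u ])                         ≡⟨ cong (sub σ) ([]≡sub₀ t u) ⟩
    sub σ (sub (sub₀ u) t)                  ≡⟨ sub-sub σ (sub₀ u) t ⟩
    sub (sub σ ∘ sub₀ u) t                  ≡⟨ sub-cong commute t ⟩
    sub (sub (sub₀ (sub σ u)) ∘ exts σ) t   ≡⟨ sub-sub (sub₀ (sub σ u)) (exts σ) t ⟨
    sub (sub₀ (sub σ u)) (sub (exts σ) t)   ≡⟨ []≡sub₀ (sub (exts σ) t) (sub σ u) ⟨
    sub (exts σ) t [ sub σ u ]              ∎
    where
      open ≡-Reasoning
      commute : ∀ i → sub σ (sub₀ u i) ≡ sub (sub₀ (sub σ u)) (exts σ i)
      commute zero    = refl
      commute (suc i) = sym (sub₀-wk (sub σ u) (σ i))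

  ren-[] : ∀ {m n} (ρ : Ren m n) (t : Tm C (suc m)) (u : Tm C m) →
           ren ρ (t [ u ]) ≡ ren (ext {C} ρ) t [ ren ρ u ]
  ren-[] ρ t u = begin
    ren ρ (t [ u ])                               ≡⟨ ren≡sub-var ρ (t [ u ]) ⟩
    sub (var ∘ ρ) (t [ u ])                       ≡⟨ sub-[] (var ∘ ρ) t u ⟩
    sub (exts (var ∘ ρ)) t [ sub (var ∘ ρ) u ]    ≡⟨ cong₂ _[_] ext-as-sub (ren≡sub-var ρ u) ⟨
    ren (ext {C} ρ) t [ ren ρ u ]                 ∎
    where
      open ≡-Reasoning
      ext-as-sub : ren (ext {C} ρ) t ≡ sub (exts (var ∘ ρ)) t
      ext-as-sub = trans (ren≡sub-var (ext {C} ρ) t) (sub-cong (λ { zero → refl ; (suc i) → refl }) t)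

  ren-ext-suc-[var-zero] : ∀ {n} (t : Tm C (suc n)) → ren (ext {C} suc) t [ var zero ] ≡ t
  ren-ext-suc-[var-zero] t = begin
    ren (ext {C} suc) t [ var zero ]                  ≡⟨ []≡sub₀ (ren (ext {C} suc) t) (var zero) ⟩
    sub (sub₀ (var zero)) (ren (ext {C} suc) t)       ≡⟨ sub-ren (sub₀ (var zero)) (ext {C} suc) t ⟩
    sub (sub₀ (var zero) ∘ ext {C} suc) t             ≡⟨ sub-cong (λ { zero → refl ; (suc i) → refl }) t ⟩
    sub var t                                         ≡⟨ sub-var t ⟩
    t                                                 ∎
    where open ≡-Reasoning

  ren-inv-var : ∀ {m n} {ρ : Ren m n} (t : Tm C m) {i} → ren ρ t ≡ var i → Σ (Fin m) λ j → (t ≡ var j) × (ρ j ≡ i)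
  ren-inv-var (var j) refl = j , refl , refl

  ren-inv-const : ∀ {m n} {ρ : Ren m n} (t : Tm C m) {c} → ren ρ t ≡ const c → t ≡ const c
  ren-inv-const (const c) refl = refl

  ren-inv-pi : ∀ {m n} {ρ : Ren m n} (t : Tm C m) {A B} → ren ρ t ≡ pi A B →
               Σ (Tm C m) λ A₀ → Σ (Tm C (suc m)) λ B₀ →
                 (t ≡ pi A₀ B₀) × (ren ρ A₀ ≡ A) × (ren (ext {C} ρ) B₀ ≡ B)
  ren-inv-pi (pi A B) refl = A , B , refl , refl , refl

  ren-inv-lam : ∀ {m n} {ρ : Ren m n} (t : Tm C m) {A b} → ren ρ t ≡ lam A b →
                Σ (Tm C m) λ A₀ → Σ (Tm C (suc m)) λ b₀ →
                  (t ≡ lam A₀ b₀) × (ren ρ A₀ ≡ A) × (ren (ext {C} ρ) b₀ ≡ b)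
  ren-inv-lam (lam A b) refl = A , b , refl , refl , refl

  ren-inv-app : ∀ {m n} {ρ : Ren m n} (t : Tm C m) {F a} → ren ρ t ≡ app F a →
                Σ (Tm C m) λ F₀ → Σ (Tm C m) λ a₀ → (t ≡ app F₀ a₀) × (ren ρ F₀ ≡ F) × (ren ρ a₀ ≡ a)
  ren-inv-app (app F a) refl = F , a , refl , refl , refl

module Closure {C : Set} (R : ∀ {n} → Tm C n → Tm C n → Set) where

  _⟶_ : ∀ {n} → Tm C n → Tm C n → Set
  _⟶_ = Comp R

  _⟶*_ : ∀ {n} → Tm C n → Tm C n → Set
  _⟶*_ = Star _⟶_

  _≈_ : ∀ {n} → Tm C n → Tm C n → Set
  _≈_ = EqClosure.EqClosure _⟶_

  ⟶*⇒≈ : ∀ {n} {t u : Tm C n} → t ⟶* u → t ≈ u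
  ⟶*⇒≈ = Star.map fwd

  ⟶*-pi : ∀ {n} {A A' : Tm C n} {B B'} → A ⟶* A' → B ⟶* B' → pi A B ⟶* pi A' B'
  ⟶*-pi {A' = A'} {B} p q = Star.gmap (λ X → pi X B) piˡ p ◅◅ Star.gmap (pi A') piʳ q

  ⟶*-lam : ∀ {n} {A A' : Tm C n} {t t'} → A ⟶* A' → t ⟶* t' → lam A t ⟶* lam A' t'
  ⟶*-lam {A' = A'} {t} p q = Star.gmap (λ X → lam X t) lamˡ p ◅◅ Star.gmap (lam A') lamʳ q

  ⟶*-app : ∀ {n} {t t' u u' : Tm C n} → t ⟶* t' → u ⟶* u' → app t u ⟶* app t' u'
  ⟶*-app {t' = t'} {u} p q = Star.gmap (λ X → app X u) appˡ p ◅◅ Star.gmap (app t') appʳ q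

  ≈-pi : ∀ {n} {A A' : Tm C n} {B B'} → A ≈ A' → B ≈ B' → pi A B ≈ pi A' B'
  ≈-pi {A' = A'} {B} p q = EqClosure.gmap (λ X → pi X B) piˡ p ◅◅ EqClosure.gmap (pi A') piʳ q

  ≈-lam : ∀ {n} {A A' : Tm C n} {t t'} → A ≈ A' → t ≈ t' → lam A t ≈ lam A' t'
  ≈-lam {A' = A'} {t} p q = EqClosure.gmap (λ X → lam X t) lamˡ p ◅◅ EqClosure.gmap (lam A') lamʳ q

  ≈-app : ∀ {n} {t t' u u' : Tm C n} → t ≈ t' → u ≈ u' → app t u ≈ app t' u'
  ≈-app {t' = t'} {u} p q = EqClosure.gmap (λ X → app X u) appˡ p ◅◅ EqClosure.gmap (app t') appʳ q

module Reduction {C : Set} where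
  open Substitution {C}
  open Closure (Beta {C}) public
    renaming (_⟶*_ to _⟶β*_; ⟶*⇒≈ to ⟶β*⇒≡β; ≈-pi to ≡β-pi; ≈-lam to ≡β-lam; ≈-app to ≡β-app)
    hiding (_⟶_; _≈_)

  module ≡β-Reasoning {n : ℕ} = SetoidReasoning (EqClosure.setoid (_⟶β_ {C} {n}))

  ⟶β⇒≡β : ∀ {n} {t u : Tm C n} → t ⟶β u → t ≡β u
  ⟶β⇒≡β = EqClosure.return

  ≡⇒≡β : ∀ {n} {t u : Tm C n} → t ≡ u → t ≡β u
  ≡⇒≡β refl = ε

  ≡β-sym : ∀ {n} {t u : Tm C n} → t ≡β u → u ≡β t
  ≡β-sym = EqClosure.symmetric _⟶β_

  ≡β-trans : ∀ {n} {t u w : Tm C n} → t ≡β u → u ≡β w → t ≡β w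
  ≡β-trans = _◅◅_

  ren-⟶β : ∀ {m n} (ρ : Ren m n) {t u : Tm C m} → t ⟶β u → ren ρ t ⟶β ren ρ u
  ren-⟶β ρ (root (beta A t u)) = subst (ren ρ (app (lam A t) u) ⟶β_) (sym (ren-[] ρ t u)) (root (beta _ _ _))
  ren-⟶β ρ (piˡ p)  = piˡ (ren-⟶β ρ p)
  ren-⟶β ρ (piʳ p)  = piʳ (ren-⟶β (ext {C} ρ) p)
  ren-⟶β ρ (lamˡ p) = lamˡ (ren-⟶β ρ p)
  ren-⟶β ρ (lamʳ p) = lamʳ (ren-⟶β (ext {C} ρ) p)
  ren-⟶β ρ (appˡ p) = appˡ (ren-⟶β ρ p)
  ren-⟶β ρ (appʳ p) = appʳ (ren-⟶β ρ p)

  sub-⟶β : ∀ {m n} (σ : Sub m n) {t u : Tm C m} → t ⟶β u → sub σ t ⟶β sub σ u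
  sub-⟶β σ (root (beta A t u)) = subst (sub σ (app (lam A t) u) ⟶β_) (sym (sub-[] σ t u)) (root (beta _ _ _))
  sub-⟶β σ (piˡ p)  = piˡ (sub-⟶β σ p)
  sub-⟶β σ (piʳ p)  = piʳ (sub-⟶β (exts σ) p)
  sub-⟶β σ (lamˡ p) = lamˡ (sub-⟶β σ p)
  sub-⟶β σ (lamʳ p) = lamʳ (sub-⟶β (exts σ) p)
  sub-⟶β σ (appˡ p) = appˡ (sub-⟶β σ p)
  sub-⟶β σ (appʳ p) = appʳ (sub-⟶β σ p)

  ren-≡β : ∀ {m n} (ρ : Ren m n) {t u : Tm C m} → t ≡β u → ren ρ t ≡β ren ρ u
  ren-≡β ρ = EqClosure.gmap (ren ρ) (ren-⟶β ρ)

  sub-≡β : ∀ {m n} (σ : Sub m n) {t u : Tm C m} → t ≡β u → sub σ t ≡β sub σ u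
  sub-≡β σ = EqClosure.gmap (sub σ) (sub-⟶β σ)

  wk-≡β : ∀ {n} {t u : Tm C n} → t ≡β u → wk t ≡β wk u
  wk-≡β = ren-≡β suc

  []-≡βˡ : ∀ {n} {t t' : Tm C (suc n)} (u : Tm C n) → t ≡β t' → t [ u ] ≡β t' [ u ]
  []-≡βˡ {t = t} {t'} u p = subst₂ _≡β_ (sym ([]≡sub₀ t u)) (sym ([]≡sub₀ t' u)) (sub-≡β (sub₀ u) p)

  const-⟶β* : ∀ {n} {c} {w : Tm C n} → const c ⟶β* w → w ≡ const c
  const-⟶β* ε              = refl
  const-⟶β* (root () ◅ ps)

  ren-⟶β-inv : ∀ {m n} (ρ : Ren m n) (t : Tm C m) {u} → ren ρ t ⟶β u →
               Σ (Tm C m) λ t' → (t ⟶β t') × (u ≡ ren ρ t')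
  ren-⟶β-inv ρ (var i)   (root ())
  ren-⟶β-inv ρ (const c) (root ())
  ren-⟶β-inv ρ (pi A B)  (root ())
  ren-⟶β-inv ρ (pi A B)  (piˡ p) with ren-⟶β-inv ρ A p
  ... | A' , q , refl = pi A' B , piˡ q , refl
  ren-⟶β-inv ρ (pi A B)  (piʳ p) with ren-⟶β-inv (ext {C} ρ) B p
  ... | B' , q , refl = pi A B' , piʳ q , refl
  ren-⟶β-inv ρ (lam A t) (root ())
  ren-⟶β-inv ρ (lam A t) (lamˡ p) with ren-⟶β-inv ρ A p
  ... | A' , q , refl = lam A' t , lamˡ q , refl
  ren-⟶β-inv ρ (lam A t) (lamʳ p) with ren-⟶β-inv (ext {C} ρ) t p
  ... | t' , q , refl = lam A t' , lamʳ q , refl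
  ren-⟶β-inv ρ (app (lam A t) u) (root (beta _ _ _)) = t [ u ] , root (beta A t u) , sym (ren-[] ρ t u)
  ren-⟶β-inv ρ (app (var i) u)   (root ())
  ren-⟶β-inv ρ (app (const c) u) (root ())
  ren-⟶β-inv ρ (app (pi A B) u)  (root ())
  ren-⟶β-inv ρ (app (app t v) u) (root ())
  ren-⟶β-inv ρ (app t u) (appˡ p) with ren-⟶β-inv ρ t p
  ... | t' , q , refl = app t' u , appˡ q , refl
  ren-⟶β-inv ρ (app t u) (appʳ p) with ren-⟶β-inv ρ u p
  ... | u' , q , refl = app t u' , appʳ q , refl

module ParallelReduction {C : Set} where
  open Substitution {C}
  open Reduction {C}

  infix 4 _⇛_
  data _⇛_ {n : ℕ} : Tm C n → Tm C n → Set where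
    ⇛-var   : ∀ {i} → var i ⇛ var i
    ⇛-const : ∀ {c} → const c ⇛ const c
    ⇛-pi    : ∀ {A A' B B'} → A ⇛ A' → B ⇛ B' → pi A B ⇛ pi A' B'
    ⇛-lam   : ∀ {A A' t t'} → A ⇛ A' → t ⇛ t' → lam A t ⇛ lam A' t'
    ⇛-app   : ∀ {t t' u u'} → t ⇛ t' → u ⇛ u' → app t u ⇛ app t' u'
    ⇛-beta  : ∀ {A t t' u u'} → t ⇛ t' → u ⇛ u' → app (lam A t) u ⇛ t' [ u' ]

  _⇛*_ : ∀ {n} → Tm C n → Tm C n → Set
  _⇛*_ = Star _⇛_

  ⇛-refl : ∀ {n} (t : Tm C n) → t ⇛ t
  ⇛-refl (var i)   = ⇛-var
  ⇛-refl (const c) = ⇛-const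
  ⇛-refl (pi A B)  = ⇛-pi (⇛-refl A) (⇛-refl B)
  ⇛-refl (lam A t) = ⇛-lam (⇛-refl A) (⇛-refl t)
  ⇛-refl (app t u) = ⇛-app (⇛-refl t) (⇛-refl u)

  ren-⇛ : ∀ {m n} (ρ : Ren m n) {t u : Tm C m} → t ⇛ u → ren ρ t ⇛ ren ρ u
  ren-⇛ ρ ⇛-var       = ⇛-var
  ren-⇛ ρ ⇛-const     = ⇛-const
  ren-⇛ ρ (⇛-pi p q)  = ⇛-pi (ren-⇛ ρ p) (ren-⇛ (ext {C} ρ) q)
  ren-⇛ ρ (⇛-lam p q) = ⇛-lam (ren-⇛ ρ p) (ren-⇛ (ext {C} ρ) q)
  ren-⇛ ρ (⇛-app p q) = ⇛-app (ren-⇛ ρ p) (ren-⇛ ρ q)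
  ren-⇛ ρ (⇛-beta {t' = t'} {u' = u'} p q) =
    subst (_ ⇛_) (sym (ren-[] ρ t' u')) (⇛-beta (ren-⇛ (ext {C} ρ) p) (ren-⇛ ρ q))

  exts-⇛ : ∀ {m n} {σ σ' : Sub m n} → (∀ i → σ i ⇛ σ' i) → ∀ i → exts σ i ⇛ exts σ' i
  exts-⇛ h zero    = ⇛-var
  exts-⇛ h (suc i) = ren-⇛ suc (h i)

  sub-⇛ : ∀ {m n} {σ σ' : Sub m n} → (∀ i → σ i ⇛ σ' i) → {t u : Tm C m} → t ⇛ u → sub σ t ⇛ sub σ' u
  sub-⇛ h (⇛-var {i}) = h i
  sub-⇛ h ⇛-const     = ⇛-const
  sub-⇛ h (⇛-pi p q)  = ⇛-pi (sub-⇛ h p) (sub-⇛ (exts-⇛ h) q)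
  sub-⇛ h (⇛-lam p q) = ⇛-lam (sub-⇛ h p) (sub-⇛ (exts-⇛ h) q)
  sub-⇛ h (⇛-app p q) = ⇛-app (sub-⇛ h p) (sub-⇛ h q)
  sub-⇛ {σ' = σ'} h (⇛-beta {t' = t'} {u' = u'} p q) =
    subst (_ ⇛_) (sym (sub-[] σ' t' u')) (⇛-beta (sub-⇛ (exts-⇛ h) p) (sub-⇛ h q))

  []-⇛ : ∀ {n} {t t' : Tm C (suc n)} {u u'} → t ⇛ t' → u ⇛ u' → t [ u ] ⇛ t' [ u' ]
  []-⇛ {t = t} {t'} {u} {u'} p q = subst₂ _⇛_ (sym ([]≡sub₀ t u)) (sym ([]≡sub₀ t' u')) (sub-⇛ sub₀-⇛ p)
    where
      sub₀-⇛ : ∀ i → sub₀ u i ⇛ sub₀ u' i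
      sub₀-⇛ zero    = q
      sub₀-⇛ (suc i) = ⇛-var

  -- Takahashi's complete development.
  complete : ∀ {n} → Tm C n → Tm C n
  complete (var i)           = var i
  complete (const c)         = const c
  complete (pi A B)          = pi (complete A) (complete B)
  complete (lam A t)         = lam (complete A) (complete t)
  complete (app (lam A t) u) = complete t [ complete u ]
  complete (app t u)         = app (complete t) (complete u)

  ⇛-complete : ∀ {n} {t u : Tm C n} → t ⇛ u → u ⇛ complete t
  ⇛-complete ⇛-var       = ⇛-var
  ⇛-complete ⇛-const     = ⇛-const
  ⇛-complete (⇛-pi p q)  = ⇛-pi (⇛-complete p) (⇛-complete q)
  ⇛-complete (⇛-lam p q) = ⇛-lam (⇛-complete p) (⇛-complete q)
  ⇛-complete (⇛-beta p q) = []-⇛ (⇛-complete p) (⇛-complete q)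
  ⇛-complete (⇛-app (⇛-lam _ p) q)  = ⇛-beta (⇛-complete p) (⇛-complete q)
  ⇛-complete (⇛-app ⇛-var q)        = ⇛-app ⇛-var (⇛-complete q)
  ⇛-complete (⇛-app ⇛-const q)      = ⇛-app ⇛-const (⇛-complete q)
  ⇛-complete (⇛-app p@(⇛-pi _ _) q)  = ⇛-app (⇛-complete p) (⇛-complete q)
  ⇛-complete (⇛-app p@(⇛-app _ _) q) = ⇛-app (⇛-complete p) (⇛-complete q)
  ⇛-complete (⇛-app p@(⇛-beta _ _) q) = ⇛-app (⇛-complete p) (⇛-complete q)

  strip : ∀ {n} {s t w : Tm C n} → s ⇛ t → s ⇛* w → Σ (Tm C n) λ v → (t ⇛* v) × (w ⇛ v)
  strip {t = t} p ε = t , ε , p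
  strip p (q ◅ qs) with strip (⇛-complete q) qs
  ... | v , tv , wv = v , (⇛-complete p ◅ tv) , wv

  ⟶β⇒⇛ : ∀ {n} {t u : Tm C n} → t ⟶β u → t ⇛ u
  ⟶β⇒⇛ (root (beta A t u)) = ⇛-beta (⇛-refl t) (⇛-refl u)
  ⟶β⇒⇛ (piˡ p)  = ⇛-pi (⟶β⇒⇛ p) (⇛-refl _)
  ⟶β⇒⇛ (piʳ p)  = ⇛-pi (⇛-refl _) (⟶β⇒⇛ p)
  ⟶β⇒⇛ (lamˡ p) = ⇛-lam (⟶β⇒⇛ p) (⇛-refl _)
  ⟶β⇒⇛ (lamʳ p) = ⇛-lam (⇛-refl _) (⟶β⇒⇛ p)
  ⟶β⇒⇛ (appˡ p) = ⇛-app (⟶β⇒⇛ p) (⇛-refl _)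
  ⟶β⇒⇛ (appʳ p) = ⇛-app (⇛-refl _) (⟶β⇒⇛ p)

  ⇛⇒⟶β* : ∀ {n} {t u : Tm C n} → t ⇛ u → t ⟶β* u
  ⇛⇒⟶β* ⇛-var        = ε
  ⇛⇒⟶β* ⇛-const      = ε
  ⇛⇒⟶β* (⇛-pi p q)   = ⟶*-pi (⇛⇒⟶β* p) (⇛⇒⟶β* q)
  ⇛⇒⟶β* (⇛-lam p q)  = ⟶*-lam (⇛⇒⟶β* p) (⇛⇒⟶β* q)
  ⇛⇒⟶β* (⇛-app p q)  = ⟶*-app (⇛⇒⟶β* p) (⇛⇒⟶β* q)
  ⇛⇒⟶β* (⇛-beta p q) = ⟶*-app (⟶*-lam ε (⇛⇒⟶β* p)) (⇛⇒⟶β* q) ◅◅ (root (beta _ _ _) ◅ ε)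

  ⇛*⇒⟶β* : ∀ {n} {t u : Tm C n} → t ⇛* u → t ⟶β* u
  ⇛*⇒⟶β* = Star.concat ∘ Star.map ⇛⇒⟶β*

  ⇛*⇒≡β : ∀ {n} {t u : Tm C n} → t ⇛* u → t ≡β u
  ⇛*⇒≡β = ⟶β*⇒≡β ∘ ⇛*⇒⟶β*

  church-rosser-⇛ : ∀ {n} {t u : Tm C n} → t ≡β u → Σ (Tm C n) λ w → (t ⇛* w) × (u ⇛* w)
  church-rosser-⇛ {t = t} ε = t , ε , ε
  church-rosser-⇛ (fwd p ◅ ps) with church-rosser-⇛ ps
  ... | w , tw , uw = w , (⟶β⇒⇛ p ◅ tw) , uw
  church-rosser-⇛ (bwd p ◅ ps) with church-rosser-⇛ ps
  ... | w , tw , uw with strip (⟶β⇒⇛ p) tw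
  ... | v , tv , wv = v , tv , (uw ◅◅ (wv ◅ ε))

  church-rosser : ∀ {n} {t u : Tm C n} → t ≡β u → Σ (Tm C n) λ w → (t ⟶β* w) × (u ⟶β* w)
  church-rosser p with church-rosser-⇛ p
  ... | w , tw , uw = w , ⇛*⇒⟶β* tw , ⇛*⇒⟶β* uw

  const-⇛* : ∀ {n} {c} {w : Tm C n} → const c ⇛* w → w ≡ const c
  const-⇛* ε              = refl
  const-⇛* (⇛-const ◅ ps) = const-⇛* ps

  pi-⇛* : ∀ {n} {A B} {w : Tm C n} → pi A B ⇛* w →
          Σ (Tm C n) λ A' → Σ (Tm C (suc n)) λ B' → (w ≡ pi A' B') × (A ⇛* A') × (B ⇛* B')
  pi-⇛* {A = A} {B} ε = A , B , refl , ε , ε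
  pi-⇛* (⇛-pi p q ◅ ps) with pi-⇛* ps
  ... | A' , B' , refl , AA' , BB' = A' , B' , refl , (p ◅ AA') , (q ◅ BB')

  const-≡β-injective : ∀ {n} {c c'} → const {C} {n} c ≡β const c' → c ≡ c'
  const-≡β-injective p with church-rosser-⇛ p
  ... | w , cw , c'w with trans (sym (const-⇛* cw)) (const-⇛* c'w)
  ... | refl = refl

  pi-≡β-injective : ∀ {n} {A A' : Tm C n} {B B'} → pi A B ≡β pi A' B' → (A ≡β A') × (B ≡β B')
  pi-≡β-injective p with church-rosser-⇛ p
  ... | w , l , r with pi-⇛* l | pi-⇛* r
  ... | _ , _ , refl , A⇛ , B⇛ | _ , _ , refl , A'⇛ , B'⇛ =
    ≡β-trans (⇛*⇒≡β A⇛) (≡β-sym (⇛*⇒≡β A'⇛)) , ≡β-trans (⇛*⇒≡β B⇛) (≡β-sym (⇛*⇒≡β B'⇛))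

  []-⟶βʳ : ∀ {n} (t : Tm C (suc n)) {u u' : Tm C n} → u ⟶β u' → t [ u ] ≡β t [ u' ]
  []-⟶βʳ t p = ⇛*⇒≡β ([]-⇛ (⇛-refl t) (⟶β⇒⇛ p) ◅ ε)

module Typing (P : PTS) where
  open PTS P
  open Substitution {Sort}
  open Reduction {Sort}
  open ParallelReduction {Sort}

  lookup : ∀ {n} → Ctx P n → Fin n → PTm P n
  lookup (Γ ▸ A) zero    = wk A
  lookup (Γ ▸ A) (suc i) = wk (lookup Γ i)

  -- Only the last entry is checked: it is typed in the rest of the context.
  WellFormed : ∀ {n} → Ctx P n → Set
  WellFormed []      = ⊤
  WellFormed (Γ ▸ A) = Σ Sort λ s → Γ ⊢ A ∶ const s

  ⊢⇒wf : ∀ {n} {Γ : Ctx P n} {t T} → Γ ⊢ t ∶ T → WellFormed Γ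
  ⊢⇒wf (axiom _)         = tt
  ⊢⇒wf (start dA)        = _ , dA
  ⊢⇒wf (weakening _ dC)  = _ , dC
  ⊢⇒wf (product _ dA _)  = ⊢⇒wf dA
  ⊢⇒wf (application d _) = ⊢⇒wf d
  ⊢⇒wf (abstraction _ d) = ⊢⇒wf d
  ⊢⇒wf (conversion d _ _) = ⊢⇒wf d

  ⊢-var : ∀ {n} {Γ : Ctx P n} → WellFormed Γ → ∀ i → Γ ⊢ var i ∶ lookup Γ i
  ⊢-var {Γ = Γ ▸ A} (_ , dA) zero    = start dA
  ⊢-var {Γ = Γ ▸ A} (_ , dA) (suc i) = weakening (⊢-var (⊢⇒wf dA) i) dA

  ⊢-axiom : ∀ {n} {Γ : Ctx P n} {s₁ s₂} → WellFormed Γ → Ax s₁ s₂ → Γ ⊢ const s₁ ∶ const s₂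
  ⊢-axiom {Γ = []}    _        a = axiom a
  ⊢-axiom {Γ = Γ ▸ A} (_ , dA) a = weakening (⊢-axiom (⊢⇒wf dA) a) dA

  ⊢-cast : ∀ {n} {Γ : Ctx P n} {t t' T T'} → t ≡ t' → T ≡ T' → Γ ⊢ t ∶ T → Γ ⊢ t' ∶ T'
  ⊢-cast refl refl d = d

  record WellTypedSub {m n} (Δ : Ctx P n) (σ : Sub m n) (Γ : Ctx P m) : Set where
    constructor _,_
    field
      wf-target : WellFormed Δ
      ⊢-image   : ∀ i → Δ ⊢ σ i ∶ sub σ (lookup Γ i)
  open WellTypedSub

  exts-wellTyped : ∀ {m n} {Δ : Ctx P n} {σ : Sub m n} {Γ A s} → WellTypedSub Δ σ Γ →
                   Δ ⊢ sub σ A ∶ const s → WellTypedSub (Δ ▸ sub σ A) (exts σ) (Γ ▸ A)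
  exts-wellTyped {σ = σ} {Γ} {A} h dσA = (_ , dσA) , image
    where
      image : ∀ i → _ ⊢ exts σ i ∶ sub (exts σ) (lookup (Γ ▸ A) i)
      image zero    = ⊢-cast refl (sym (sub-exts-wk σ A)) (start dσA)
      image (suc i) = ⊢-cast refl (sym (sub-exts-wk σ (lookup Γ i))) (weakening (⊢-image h i) dσA)

  ⊢-sub : ∀ {m n} {Γ : Ctx P m} {Δ : Ctx P n} {σ : Sub m n} {t T} → Γ ⊢ t ∶ T →
          WellTypedSub Δ σ Γ → Δ ⊢ sub σ t ∶ sub σ T
  ⊢-sub-last : ∀ {m n} {Γ : Ctx P m} {Δ : Ctx P n} {σ : Sub m n} {A t T} → (Γ ▸ A) ⊢ t ∶ T →
               WellTypedSub Δ σ Γ → Σ Sort λ s → Δ ⊢ sub σ A ∶ const s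

  ⊢-sub (axiom a) h = ⊢-axiom (wf-target h) a
  ⊢-sub (start _) h = ⊢-image h zero
  ⊢-sub {Γ = Γ ▸ C} {σ = σ} (weakening {A = A} {B} d _) h =
    ⊢-cast (sym (sub-ren σ suc A)) (sym (sub-ren σ suc B))
      (⊢-sub d (wf-target h , λ i → ⊢-cast refl (sub-ren σ suc (lookup Γ i)) (⊢-image h (suc i))))
  ⊢-sub (product r dA dB) h = product r (⊢-sub dA h) (⊢-sub dB (exts-wellTyped h (⊢-sub dA h)))
  ⊢-sub {σ = σ} (application {B = B} {a} dF da) h =
    ⊢-cast refl (sym (sub-[] σ B a)) (application (⊢-sub dF h) (⊢-sub da h))
  ⊢-sub (abstraction db dΠ) h = abstraction (⊢-sub db (exts-wellTyped h (proj₂ (⊢-sub-last db h)))) (⊢-sub dΠ h)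
  ⊢-sub {σ = σ} (conversion d dB' B≡B') h = conversion (⊢-sub d h) (⊢-sub dB' h) (sub-≡β σ B≡B')

  ⊢-sub-last (start dA)         h = _ , ⊢-sub dA h
  ⊢-sub-last (weakening _ dC)   h = _ , ⊢-sub dC h
  ⊢-sub-last (product _ dA _)   h = ⊢-sub-last dA h
  ⊢-sub-last (application d _)  h = ⊢-sub-last d h
  ⊢-sub-last (abstraction _ d)  h = ⊢-sub-last d h
  ⊢-sub-last (conversion d _ _) h = ⊢-sub-last d h

  sub₀-wellTyped : ∀ {n} {Γ : Ctx P n} {A a} → Γ ⊢ a ∶ A → WellTypedSub Γ (sub₀ a) (Γ ▸ A)
  sub₀-wellTyped {Γ = Γ} {A} {a} da = ⊢⇒wf da , image
    where
      image : ∀ i → Γ ⊢ sub₀ a i ∶ sub (sub₀ a) (lookup (Γ ▸ A) i)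
      image zero    = ⊢-cast refl (sym (sub₀-wk a A)) da
      image (suc i) = ⊢-cast refl (sym (sub₀-wk a (lookup Γ i))) (⊢-var (⊢⇒wf da) i)

  ⊢-[] : ∀ {n} {Γ : Ctx P n} {A t T a} → (Γ ▸ A) ⊢ t ∶ T → Γ ⊢ a ∶ A → Γ ⊢ t [ a ] ∶ T [ a ]
  ⊢-[] {t = t} {T} {a} d da = ⊢-cast (sym ([]≡sub₀ t a)) (sym ([]≡sub₀ T a)) (⊢-sub d (sub₀-wellTyped da))

  record WellTypedRen {m n} (Δ : Ctx P n) (ρ : Ren m n) (Γ : Ctx P m) : Set where
    constructor _,_
    field
      wf-target : WellFormed Δ
      ⊢-image   : ∀ i → Δ ⊢ var (ρ i) ∶ ren ρ (lookup Γ i)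

  ⊢-ren : ∀ {m n} {Γ : Ctx P m} {Δ : Ctx P n} {ρ : Ren m n} {t T} → Γ ⊢ t ∶ T →
          WellTypedRen Δ ρ Γ → Δ ⊢ ren ρ t ∶ ren ρ T
  ⊢-ren {Γ = Γ} {ρ = ρ} {t} {T} d (wf , image) =
    ⊢-cast (sym (ren≡sub-var ρ t)) (sym (ren≡sub-var ρ T))
      (⊢-sub d (wf , λ i → ⊢-cast refl (ren≡sub-var ρ (lookup Γ i)) (image i)))

  ext-wellTyped : ∀ {m n} {Δ : Ctx P n} {ρ : Ren m n} {Γ A s} → WellTypedRen Δ ρ Γ →
                  Δ ⊢ ren ρ A ∶ const s → WellTypedRen (Δ ▸ ren ρ A) (ext {Sort} ρ) (Γ ▸ A)
  ext-wellTyped {ρ = ρ} {Γ} {A} (_ , image) dρA = (_ , dρA) , image'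
    where
      image' : ∀ i → _ ⊢ var (ext {Sort} ρ i) ∶ ren (ext {Sort} ρ) (lookup (Γ ▸ A) i)
      image' zero    = ⊢-cast refl (sym (ren-ext-wk ρ A)) (start dρA)
      image' (suc i) = ⊢-cast refl (sym (ren-ext-wk ρ (lookup Γ i))) (weakening (image i) dρA)

  suc-wellTyped : ∀ {n} {Δ : Ctx P n} {C s} → Δ ⊢ C ∶ const s → WellTypedRen (Δ ▸ C) suc Δ
  suc-wellTyped dC = (_ , dC) , λ i → weakening (⊢-var (⊢⇒wf dC) i) dC

  ⊢-weaken-under : ∀ {n} {Γ : Ctx P n} {A C s t T} → (Γ ▸ A) ⊢ t ∶ T → Γ ⊢ C ∶ const s →
                   ((Γ ▸ C) ▸ wk A) ⊢ ren (ext {Sort} suc) t ∶ ren (ext {Sort} suc) T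
  ⊢-weaken-under d dC = ⊢-ren d (ext-wellTyped (suc-wellTyped dC) (weakening (proj₂ (⊢⇒wf d)) dC))

  conv-wellTyped : ∀ {n} {Γ : Ctx P n} {A A' s s'} → Γ ⊢ A ∶ const s → Γ ⊢ A' ∶ const s' → A ≡β A' →
                   WellTypedSub (Γ ▸ A') var (Γ ▸ A)
  conv-wellTyped {Γ = Γ} {A} {A'} dA dA' A≡A' = (_ , dA') , image
    where
      image : ∀ i → (Γ ▸ A') ⊢ var i ∶ sub var (lookup (Γ ▸ A) i)
      image zero    =
        ⊢-cast refl (sym (sub-var (wk A))) (conversion (start dA') (weakening dA dA') (wk-≡β (≡β-sym A≡A')))
      image (suc i) = ⊢-cast refl (sym (sub-var _)) (weakening (⊢-var (⊢⇒wf dA) i) dA')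

  ⊢-ctx-conv : ∀ {n} {Γ : Ctx P n} {A A' s' t T} → (Γ ▸ A) ⊢ t ∶ T → Γ ⊢ A' ∶ const s' → A ≡β A' →
               (Γ ▸ A') ⊢ t ∶ T
  ⊢-ctx-conv {t = t} {T} d dA' A≡A' =
    ⊢-cast (sub-var t) (sub-var T) (⊢-sub d (conv-wellTyped (proj₂ (⊢⇒wf d)) dA' A≡A'))

  -- The subject is given up to an equation so that the weakening case
  -- can recurse after inverting the renaming.
  generation-var : ∀ {n} {Γ : Ctx P n} {t T i} → Γ ⊢ t ∶ T → t ≡ var i → T ≡β lookup Γ i
  generation-var (start _) refl = ε
  generation-var (weakening {A = A} d _) eq with ren-inv-var A eq
  ... | _ , refl , refl = wk-≡β (generation-var d refl)
  generation-var (conversion d _ B≡B') eq = ≡β-trans (≡β-sym B≡B') (generation-var d eq)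

  generation-const : ∀ {n} {Γ : Ctx P n} {t T s} → Γ ⊢ t ∶ T → t ≡ const s →
                     Σ Sort λ s' → Ax s s' × (T ≡β const s')
  generation-const (axiom a) refl = _ , a , ε
  generation-const (weakening {A = A} d _) eq with ren-inv-const A eq
  ... | refl with generation-const d refl
  ... | s' , a , T≡s' = s' , a , wk-≡β T≡s'
  generation-const (conversion d _ B≡B') eq with generation-const d eq
  ... | s' , a , B≡s' = s' , a , ≡β-trans (≡β-sym B≡B') B≡s'

  PiGeneration : ∀ {n} → Ctx P n → PTm P n → PTm P (suc n) → PTm P n → Set
  PiGeneration Γ A B T = Σ Sort λ s₁ → Σ Sort λ s₂ → Σ Sort λ s₃ → Rl s₁ s₂ s₃ ×
                         (Γ ⊢ A ∶ const s₁) × ((Γ ▸ A) ⊢ B ∶ const s₂) × (T ≡β const s₃)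

  generation-pi : ∀ {n} {Γ : Ctx P n} {t T A B} → Γ ⊢ t ∶ T → t ≡ pi A B → PiGeneration Γ A B T
  generation-pi (weakening {A = t} d dC) eq with ren-inv-pi t eq
  ... | _ , _ , refl , refl , refl with generation-pi d refl
  ... | _ , _ , _ , r , dA , dB , T≡s₃ = _ , _ , _ , r , weakening dA dC , ⊢-weaken-under dB dC , wk-≡β T≡s₃
  generation-pi (product r dA dB) refl = _ , _ , _ , r , dA , dB , ε
  generation-pi (conversion d _ B≡B') eq with generation-pi d eq
  ... | _ , _ , _ , r , dA , dB , B≡s₃ = _ , _ , _ , r , dA , dB , ≡β-trans (≡β-sym B≡B') B≡s₃

  LamGeneration : ∀ {n} → Ctx P n → PTm P n → PTm P (suc n) → PTm P n → Set
  LamGeneration Γ A b T = Σ (PTm P (suc _)) λ B → Σ Sort λ s →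
                          ((Γ ▸ A) ⊢ b ∶ B) × (Γ ⊢ pi A B ∶ const s) × (T ≡β pi A B)

  generation-lam : ∀ {n} {Γ : Ctx P n} {t T A b} → Γ ⊢ t ∶ T → t ≡ lam A b → LamGeneration Γ A b T
  generation-lam (weakening {A = t} d dC) eq with ren-inv-lam t eq
  ... | _ , _ , refl , refl , refl with generation-lam d refl
  ... | B , _ , db , dΠ , T≡Π = ren (ext {Sort} suc) B , _ , ⊢-weaken-under db dC , weakening dΠ dC , wk-≡β T≡Π
  generation-lam (abstraction db dΠ) refl = _ , _ , db , dΠ , ε
  generation-lam (conversion d _ B≡B') eq with generation-lam d eq
  ... | B , _ , db , dΠ , B≡Π = B , _ , db , dΠ , ≡β-trans (≡β-sym B≡B') B≡Π

  AppGeneration : ∀ {n} → Ctx P n → PTm P n → PTm P n → PTm P n → Set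
  AppGeneration Γ F a T = Σ (PTm P _) λ A → Σ (PTm P (suc _)) λ B →
                          (Γ ⊢ F ∶ pi A B) × (Γ ⊢ a ∶ A) × (T ≡β B [ a ])

  generation-app : ∀ {n} {Γ : Ctx P n} {t T F a} → Γ ⊢ t ∶ T → t ≡ app F a → AppGeneration Γ F a T
  generation-app (weakening {A = t} d dC) eq with ren-inv-app t eq
  ... | _ , a , refl , refl , refl with generation-app d refl
  ... | A , B , dF , da , T≡B[a] = wk A , ren (ext {Sort} suc) B , weakening dF dC , weakening da dC ,
        ≡β-trans (wk-≡β T≡B[a]) (≡⇒≡β (ren-[] suc B a))
  generation-app (application dF da) refl = _ , _ , dF , da , ε
  generation-app (conversion d _ B≡B') eq with generation-app d eq
  ... | A , B , dF , da , B≡B[a] = A , B , dF , da , ≡β-trans (≡β-sym B≡B') B≡B[a]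

  type-correctness : ∀ {n} {Γ : Ctx P n} {t T} → Γ ⊢ t ∶ T →
                     (Σ Sort λ s → T ≡ const s) ⊎ (Σ Sort λ s → Γ ⊢ T ∶ const s)
  codomain-typed : ∀ {n} {Γ : Ctx P n} {F A B a} → Γ ⊢ F ∶ pi A B → Γ ⊢ a ∶ A →
                   Σ Sort λ s → Γ ⊢ B [ a ] ∶ const s

  type-correctness (axiom _)       = inj₁ (_ , refl)
  type-correctness (start dA)      = inj₂ (_ , weakening dA dA)
  type-correctness (weakening d dC) with type-correctness d
  ... | inj₁ (s , refl) = inj₁ (s , refl)
  ... | inj₂ (s , dT)   = inj₂ (s , weakening dT dC)
  type-correctness (product _ _ _)     = inj₁ (_ , refl)
  type-correctness (application dF da) = inj₂ (codomain-typed dF da)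
  type-correctness (abstraction _ dΠ)  = inj₂ (_ , dΠ)
  type-correctness (conversion _ dB' _) = inj₂ (_ , dB')

  codomain-typed dF da with type-correctness dF
  ... | inj₁ (_ , ())
  ... | inj₂ (_ , dΠ) with generation-pi dΠ refl
  ... | _ , _ , _ , _ , _ , dB , _ = _ , ⊢-[] dB da

  subject-reduction : ∀ {n} {Γ : Ctx P n} {t t' T} → Γ ⊢ t ∶ T → t ⟶β t' → Γ ⊢ t' ∶ T
  subject-reduction (axiom _) (root ())
  subject-reduction (start _) (root ())
  subject-reduction (weakening {A = t} d dC) p with ren-⟶β-inv suc t p
  ... | _ , q , refl = weakening (subject-reduction d q) dC
  subject-reduction (product _ _ _) (root ())
  subject-reduction (product r dA dB) (piˡ p) =
    product r (subject-reduction dA p) (⊢-ctx-conv dB (subject-reduction dA p) (⟶β⇒≡β p))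
  subject-reduction (product r dA dB) (piʳ p) = product r dA (subject-reduction dB p)
  subject-reduction (application dF da) (root (beta _ _ u)) with generation-lam dF refl
  ... | _ , _ , db , dΠ , Π≡Π' with pi-≡β-injective Π≡Π' | generation-pi dΠ refl
  ... | A≡A' , B≡B' | _ , _ , _ , _ , dA' , _ , _ =
    conversion (⊢-[] db (conversion da dA' A≡A')) (proj₂ (codomain-typed dF da)) ([]-≡βˡ u (≡β-sym B≡B'))
  subject-reduction (application dF da) (appˡ p) = application (subject-reduction dF p) da
  subject-reduction (application {B = B} dF da) (appʳ p) =
    conversion (application dF (subject-reduction da p)) (proj₂ (codomain-typed dF da)) (≡β-sym ([]-⟶βʳ B p))
  subject-reduction (abstraction _ _) (root ())
  subject-reduction (abstraction db dΠ) (lamˡ p) with subject-reduction dΠ (piˡ p)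
  ... | dΠ' with generation-pi dΠ' refl
  ... | _ , _ , _ , _ , dA' , _ , _ =
    conversion (abstraction (⊢-ctx-conv db dA' (⟶β⇒≡β p)) dΠ') dΠ (≡β-sym (⟶β⇒≡β (piˡ p)))
  subject-reduction (abstraction db dΠ) (lamʳ p) = abstraction (subject-reduction db p) dΠ
  subject-reduction (conversion d dB' B≡B') p = conversion (subject-reduction d p) dB' B≡B'

  subject-reduction* : ∀ {n} {Γ : Ctx P n} {t t' T} → Γ ⊢ t ∶ T → t ⟶β* t' → Γ ⊢ t' ∶ T
  subject-reduction* d ε        = d
  subject-reduction* d (p ◅ ps) = subject-reduction* (subject-reduction d p) ps

module UniquenessOfTypes (P : PTS) (F : IsFunctional P) where
  open PTS P
  open IsFunctional F
  open Reduction {Sort}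
  open ParallelReduction {Sort}
  open Typing P

  type-unique : ∀ {n} {Γ : Ctx P n} (t : PTm P n) {T T'} → Γ ⊢ t ∶ T → Γ ⊢ t ∶ T' → T ≡β T'
  type-unique (var i) d d' = ≡β-trans (generation-var d refl) (≡β-sym (generation-var d' refl))
  type-unique (const s) d d' with generation-const d refl | generation-const d' refl
  ... | _ , a , T≡s₂ | _ , a' , T'≡s₂' with ax-functional a a'
  ... | refl = ≡β-trans T≡s₂ (≡β-sym T'≡s₂')
  type-unique (pi A B) d d' with generation-pi d refl | generation-pi d' refl
  ... | _ , _ , _ , r , dA , dB , T≡s₃ | _ , _ , _ , r' , dA' , dB' , T'≡s₃'
      with const-≡β-injective (type-unique A dA dA') | const-≡β-injective (type-unique B dB dB')
  ... | refl | refl with rl-functional r r'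
  ... | refl = ≡β-trans T≡s₃ (≡β-sym T'≡s₃')
  type-unique (lam A b) d d' with generation-lam d refl | generation-lam d' refl
  ... | _ , _ , db , _ , T≡Π | _ , _ , db' , _ , T'≡Π' =
    ≡β-trans T≡Π (≡β-trans (≡β-pi ε (type-unique b db db')) (≡β-sym T'≡Π'))
  type-unique (app F a) d d' with generation-app d refl | generation-app d' refl
  ... | _ , _ , dF , _ , T≡B[a] | _ , _ , dF' , _ , T'≡B'[a] =
    ≡β-trans T≡B[a] (≡β-trans ([]-≡βˡ a (proj₂ (pi-≡β-injective (type-unique F dF dF')))) (≡β-sym T'≡B'[a]))

  sort-unique : ∀ {n} {Γ : Ctx P n} {t s s'} → Γ ⊢ t ∶ const s → Γ ⊢ t ∶ const s' → s ≡ s'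
  sort-unique {t = t} d d' = const-≡β-injective (type-unique t d d')

module Translation (P : PTS) where
  open PTS P
  open Substitution {Sort}
  open Reduction {Sort}
  open ParallelReduction {Sort}
  open Typing P
  module L = Substitution {LConst P}
  open Closure (BetaRw {P}) using ()
    renaming (_⟶*_ to _⟶λΠ*_; ⟶*-app to ⟶λΠ*-app; ⟶*-lam to ⟶λΠ*-lam)

  Tr-ren : ∀ {m n} {Γ : Ctx P m} {Δ : Ctx P n} {ρ : Ren m n} {t a} → Tr Γ t a →
           WellTypedRen Δ ρ Γ → Tr Δ (ren ρ t) (ren ρ a)
  Tr-ren (tr-var i)  h = tr-var _
  Tr-ren (tr-sort a) h = tr-sort a
  Tr-ren {ρ = ρ} (tr-pi {b = b} r dA dB dΠ trA trB) h =
    subst (λ b' → Tr _ _ (app (app (const (Πdot _ _ _ r)) (ren ρ _)) (lam (app (const (ε _)) (ren ρ _)) b')))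
      (L.ren-cong (ext-independent {Sort} {LConst P} ρ) b)
      (tr-pi r (⊢-ren dA h) (⊢-ren dB h') (⊢-ren dΠ h) (Tr-ren trA h) (Tr-ren trB h'))
    where h' = ext-wellTyped h (⊢-ren dA h)
  Tr-ren {ρ = ρ} (tr-lam {u = u} dA trA trt) h =
    subst (λ u' → Tr _ _ (lam (app (const (ε _)) (ren ρ _)) u')) (L.ren-cong (ext-independent {Sort} {LConst P} ρ) u)
      (tr-lam (⊢-ren dA h) (Tr-ren trA h) (Tr-ren trt (ext-wellTyped h (⊢-ren dA h))))
  Tr-ren (tr-app p q) h = tr-app (Tr-ren p h) (Tr-ren q h)

  exts-Tr : ∀ {m n} {Γ : Ctx P m} {Δ : Ctx P n} {σ : Sub m n} {A s} → Γ ⊢ A ∶ const s → WellTypedSub Δ σ Γ →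
            (τ : L.Sub m n) → (∀ i → Tr Δ (σ i) (τ i)) → ∀ i → Tr (Δ ▸ sub σ A) (exts σ i) (exts τ i)
  exts-Tr dA h τ στ zero    = tr-var zero
  exts-Tr dA h τ στ (suc i) = Tr-ren (στ i) (suc-wellTyped (⊢-sub dA h))

  Tr-sub : ∀ {m n} {Γ : Ctx P m} {Δ : Ctx P n} {σ : Sub m n} {t a} → Tr Γ t a → WellTypedSub Δ σ Γ →
           (τ : L.Sub m n) → (∀ i → Tr Δ (σ i) (τ i)) → Tr Δ (sub σ t) (sub τ a)
  Tr-sub (tr-var i)  h τ στ = στ i
  Tr-sub (tr-sort a) h τ στ = tr-sort a
  Tr-sub (tr-pi r dA dB dΠ trA trB) h τ στ =
    tr-pi r (⊢-sub dA h) (⊢-sub dB h') (⊢-sub dΠ h) (Tr-sub trA h τ στ) (Tr-sub trB h' (exts τ) (exts-Tr dA h τ στ))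
    where h' = exts-wellTyped h (⊢-sub dA h)
  Tr-sub (tr-lam dA trA trt) h τ στ =
    tr-lam (⊢-sub dA h) (Tr-sub trA h τ στ)
      (Tr-sub trt (exts-wellTyped h (⊢-sub dA h)) (exts τ) (exts-Tr dA h τ στ))
  Tr-sub (tr-app p q) h τ στ = tr-app (Tr-sub p h τ στ) (Tr-sub q h τ στ)

  Tr-[] : ∀ {n} {Γ : Ctx P n} {A t a u b} → Tr (Γ ▸ A) t a → Γ ⊢ u ∶ A → Tr Γ u b → Tr Γ (t [ u ]) (a [ b ])
  Tr-[] {Γ = Γ} {t = t} {a} {u} {b} trt du tru =
    subst₂ (Tr Γ) (sym ([]≡sub₀ t u)) (sym (L.[]≡sub₀ a b)) (Tr-sub trt (sub₀-wellTyped du) (L.sub₀ b) sub₀-Tr)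
    where
      sub₀-Tr : ∀ i → Tr Γ (sub₀ u i) (L.sub₀ b i)
      sub₀-Tr zero    = tru
      sub₀-Tr (suc i) = tr-var i

  Tr-ctx-conv : ∀ {n} {Γ : Ctx P n} {A A' s s' t a} → Tr (Γ ▸ A) t a → Γ ⊢ A ∶ const s → Γ ⊢ A' ∶ const s' →
                A ≡β A' → Tr (Γ ▸ A') t a
  Tr-ctx-conv {t = t} {a} tr dA dA' A≡A' =
    subst₂ (Tr _) (sub-var t) (L.sub-var a) (Tr-sub tr (conv-wellTyped dA dA' A≡A') var tr-var)

  Tr-⟶β : ∀ {n} {Γ : Ctx P n} {t t' T a} → Γ ⊢ t ∶ T → Tr Γ t a → t ⟶β t' →
          Σ (LTm P n) λ a' → Tr Γ t' a' × (a ⟶λΠ* a')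
  Tr-⟶β _ (tr-pi r dA dB dΠ trA trB) (piˡ p) with Tr-⟶β dA trA p
  ... | a' , trA' , a⟶a' =
    _ , tr-pi r dA' (⊢-ctx-conv dB dA' A≡A') (subject-reduction dΠ (piˡ p)) trA' (Tr-ctx-conv trB dA dA' A≡A') ,
    ⟶λΠ*-app (⟶λΠ*-app ε a⟶a') (⟶λΠ*-lam (⟶λΠ*-app ε a⟶a') ε)
    where
      dA' = subject-reduction dA p
      A≡A' = ⟶β⇒≡β p
  Tr-⟶β _ (tr-pi r dA dB dΠ trA trB) (piʳ p) with Tr-⟶β dB trB p
  ... | b' , trB' , b⟶b' =
    _ , tr-pi r dA (subject-reduction dB p) (subject-reduction dΠ (piʳ p)) trA trB' , ⟶λΠ*-app ε (⟶λΠ*-lam ε b⟶b')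
  Tr-⟶β _ (tr-lam dA trA trt) (lamˡ p) with Tr-⟶β dA trA p
  ... | a' , trA' , a⟶a' =
    _ , tr-lam (subject-reduction dA p) trA' (Tr-ctx-conv trt dA (subject-reduction dA p) (⟶β⇒≡β p)) ,
    ⟶λΠ*-lam (⟶λΠ*-app ε a⟶a') ε
  Tr-⟶β d (tr-lam dA trA trt) (lamʳ p) with generation-lam d refl
  ... | _ , _ , dt , _ , _ with Tr-⟶β dt trt p
  ... | u' , trt' , u⟶u' = _ , tr-lam dA trA trt' , ⟶λΠ*-lam ε u⟶u'
  Tr-⟶β d (tr-app trF tru) (appˡ p) with generation-app d refl
  ... | _ , _ , dF , _ , _ with Tr-⟶β dF trF p
  ... | a' , trF' , a⟶a' = _ , tr-app trF' tru , ⟶λΠ*-app a⟶a' ε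
  Tr-⟶β d (tr-app trF tru) (appʳ p) with generation-app d refl
  ... | _ , _ , _ , du , _ with Tr-⟶β du tru p
  ... | b' , tru' , b⟶b' = _ , tr-app trF tru' , ⟶λΠ*-app ε b⟶b'
  Tr-⟶β d (tr-app (tr-lam dA trA trt) tru) (root (beta _ _ _)) with generation-app d refl
  ... | _ , _ , dF , du , _ with generation-lam dF refl
  ... | _ , _ , _ , _ , Π≡Π' =
    _ , Tr-[] trt (conversion du dA (proj₁ (pi-≡β-injective Π≡Π'))) tru , (root (by-β (beta _ _ _)) ◅ ε)

  Tr-⟶β* : ∀ {n} {Γ : Ctx P n} {t t' T a} → Γ ⊢ t ∶ T → Tr Γ t a → t ⟶β* t' →
           Σ (LTm P n) λ a' → Tr Γ t' a' × (a ⟶λΠ* a')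
  Tr-⟶β* d tr ε = _ , tr , ε
  Tr-⟶β* d tr (p ◅ ps) with Tr-⟶β d tr p
  ... | a' , tr' , a⟶a' with Tr-⟶β* (subject-reduction d p) tr' ps
  ... | a'' , tr'' , a'⟶a'' = a'' , tr'' , (a⟶a' ◅◅ a'⟶a'')

module NormConversion (P : PTS) (F : IsFunctional P) where
  open PTS P
  open IsFunctional F
  open Reduction {Sort}
  open ParallelReduction {Sort}
  open Typing P
  open UniquenessOfTypes P F
  open Translation P
  open Closure (BetaRw {P}) using () renaming (⟶*-app to ⟶λΠ*-app; ⟶*⇒≈ to ⟶λΠ*⇒≡λΠ)

  Tr-deterministic : ∀ {n} {Γ : Ctx P n} {t a a'} → Tr Γ t a → Tr Γ t a' → a ≡ a'
  Tr-deterministic (tr-var i) (tr-var .i) = refl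
  Tr-deterministic (tr-sort a) (tr-sort a') with ax-functional a a'
  ... | refl = refl
  Tr-deterministic (tr-pi r dA dB _ trA trB) (tr-pi r' dA' dB' _ trA' trB')
    with sort-unique dA dA' | sort-unique dB dB'
  ... | refl | refl with rl-functional r r'
  ... | refl = cong₂ (λ a b → app (app (const (Πdot _ _ _ r)) a) (lam (app (const (ε _)) a) b))
                     (Tr-deterministic trA trA') (Tr-deterministic trB trB')
  Tr-deterministic (tr-lam dA trA trt) (tr-lam dA' trA' trt') with sort-unique dA dA'
  ... | refl = cong₂ (λ a u → lam (app (const (ε _)) a) u) (Tr-deterministic trA trA') (Tr-deterministic trt trt')
  Tr-deterministic (tr-app p q) (tr-app p' q') = cong₂ app (Tr-deterministic p p') (Tr-deterministic q q')

  Norm-≡β⇒≡λΠ : ∀ {n} (Γ : Ctx P n) (A B : PTm P n) (X Y : LTm P n) →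
                Norm Γ A X → Norm Γ B Y → A ≡β B → X ≡λΠ Y
  Norm-≡β⇒≡λΠ Γ A B X Y (norm-typed dA trA) (norm-typed dB trB) A≡B with church-rosser A≡B
  ... | C , A⟶C , B⟶C with Tr-⟶β* dA trA A⟶C | Tr-⟶β* dB trB B⟶C
  ... | c , trC , a⟶c | c' , trC' , b⟶c'
      with Tr-deterministic trC trC' | sort-unique (subject-reduction* dA A⟶C) (subject-reduction* dB B⟶C)
  ... | refl | refl =
    ⟶λΠ*⇒≡λΠ (⟶λΠ*-app ε a⟶c) ◅◅ EqClosure.symmetric _⟶λΠ_ (⟶λΠ*⇒≡λΠ (⟶λΠ*-app ε b⟶c'))
  Norm-≡β⇒≡λΠ Γ A B X Y (norm-typed dA _) (norm-top untypable) A≡B with church-rosser A≡B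
  ... | _ , A⟶C , B⟶C with const-⟶β* B⟶C
  ... | refl = ⊥-elim (untypable Γ _ (subject-reduction* dA A⟶C))
  Norm-≡β⇒≡λΠ Γ A B X Y (norm-top untypable) (norm-typed dB _) A≡B with church-rosser A≡B
  ... | _ , A⟶C , B⟶C with const-⟶β* A⟶C
  ... | refl = ⊥-elim (untypable Γ _ (subject-reduction* dB B⟶C))
  Norm-≡β⇒≡λΠ Γ A B X Y (norm-top _) (norm-top _) A≡B with const-≡β-injective A≡B
  ... | refl = ε

module BackTranslation (P : PTS) (s₀ : PTS.Sort P) where
  open PTS P
  open Substitution {Sort}
  open Reduction {Sort}
  module L = Substitution {LConst P}

  infix 30 _*
  _* : ∀ {n} → LTm P n → PTm P n
  _* = back s₀

  -- The unapplied ε and Π̇ are back-translated to λ-terms, so that the two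
  -- special clauses of backApp are β-reducts of the generic one.
  backApp-≡β : ∀ {n} (t u : LTm P n) → backApp s₀ t u ≡β app (t *) (u *)
  backApp-≡β (const (ε s)) u = ≡β-sym (⟶β⇒≡β (root (beta _ _ _)))
  backApp-≡β (app (const (Πdot _ _ _ _)) A) B =
    ≡β-sym (⟶β⇒≡β (appˡ (root (beta _ _ _))) ◅◅ ⟶β⇒≡β (root (beta _ _ _)) ◅◅
            ≡⇒≡β (trans ([]≡sub₀ (pi (wk (A *)) (app (var (suc zero)) (var zero))) (B *))
                        (cong₂ pi (sub₀-wk (B *) (A *)) refl)))
  backApp-≡β (var _) _                        = ε
  backApp-≡β (const Type) _                   = ε
  backApp-≡β (const Kind) _                   = ε
  backApp-≡β (const (U _)) _                  = ε
  backApp-≡β (const (dot _ _ _)) _            = ε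
  backApp-≡β (const (Πdot _ _ _ _)) _         = ε
  backApp-≡β (pi _ _) _                       = ε
  backApp-≡β (lam _ _) _                      = ε
  backApp-≡β (app (var _) _) _                = ε
  backApp-≡β (app (const Type) _) _           = ε
  backApp-≡β (app (const Kind) _) _           = ε
  backApp-≡β (app (const (U _)) _) _          = ε
  backApp-≡β (app (const (ε _)) _) _          = ε
  backApp-≡β (app (const (dot _ _ _)) _) _    = ε
  backApp-≡β (app (pi _ _) _) _               = ε
  backApp-≡β (app (lam _ _) _) _              = ε
  backApp-≡β (app (app _ _) _) _              = ε

  sub-backConst : ∀ {m n} (σ : Sub m n) (c : LConst P) → sub σ (backConst s₀ c) ≡ backConst s₀ c
  sub-backConst σ Type             = refl
  sub-backConst σ Kind             = refl
  sub-backConst σ (U _)            = refl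
  sub-backConst σ (ε _)            = refl
  sub-backConst σ (dot _ _ _)      = refl
  sub-backConst σ (Πdot _ _ _ _)   = refl

  back-ren : ∀ {m n} (ρ : Ren m n) (t : LTm P m) → ren ρ t * ≡β ren ρ (t *)
  back-ren ρ (var i)   = ε
  back-ren ρ (const c) = ≡⇒≡β (sym (trans (ren≡sub-var ρ (backConst s₀ c)) (sub-backConst (var ∘ ρ) c)))
  back-ren ρ (pi A B)  = ≡β-pi (back-ren ρ A)
    (≡β-trans (back-ren (ext {LConst P} ρ) B) (≡⇒≡β (ren-cong (ext-independent {LConst P} {Sort} ρ) (B *))))
  back-ren ρ (lam A t) = ≡β-lam (back-ren ρ A)
    (≡β-trans (back-ren (ext {LConst P} ρ) t) (≡⇒≡β (ren-cong (ext-independent {LConst P} {Sort} ρ) (t *))))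
  back-ren ρ (app t u) = begin
    backApp s₀ (ren ρ t) (ren ρ u)     ≈⟨ backApp-≡β (ren ρ t) (ren ρ u) ⟩
    app (ren ρ t *) (ren ρ u *)        ≈⟨ ≡β-app (back-ren ρ t) (back-ren ρ u) ⟩
    ren ρ (app (t *) (u *))            ≈⟨ ren-≡β ρ (backApp-≡β t u) ⟨
    ren ρ (backApp s₀ t u)             ∎
    where open ≡β-Reasoning

  exts-back : ∀ {m n} (σ : L.Sub m n) (τ : Sub m n) → (∀ i → σ i * ≡β τ i) → ∀ i → exts σ i * ≡β exts τ i
  exts-back σ τ στ zero    = ε
  exts-back σ τ στ (suc i) = ≡β-trans (back-ren suc (σ i)) (wk-≡β (στ i))

  back-sub : ∀ {m n} (σ : L.Sub m n) (τ : Sub m n) → (∀ i → σ i * ≡β τ i) →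
             (t : LTm P m) → sub σ t * ≡β sub τ (t *)
  back-sub σ τ στ (var i)   = στ i
  back-sub σ τ στ (const c) = ≡⇒≡β (sym (sub-backConst τ c))
  back-sub σ τ στ (pi A B)  = ≡β-pi (back-sub σ τ στ A) (back-sub (exts σ) (exts τ) (exts-back σ τ στ) B)
  back-sub σ τ στ (lam A t) = ≡β-lam (back-sub σ τ στ A) (back-sub (exts σ) (exts τ) (exts-back σ τ στ) t)
  back-sub σ τ στ (app t u) = begin
    backApp s₀ (sub σ t) (sub σ u)     ≈⟨ backApp-≡β (sub σ t) (sub σ u) ⟩
    app (sub σ t *) (sub σ u *)        ≈⟨ ≡β-app (back-sub σ τ στ t) (back-sub σ τ στ u) ⟩
    sub τ (app (t *) (u *))            ≈⟨ sub-≡β τ (backApp-≡β t u) ⟨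
    sub τ (backApp s₀ t u)             ∎
    where open ≡β-Reasoning

  back-[] : ∀ {n} (t : LTm P (suc n)) (u : LTm P n) → (t [ u ]) * ≡β t * [ u * ]
  back-[] t u = begin
    (t [ u ]) *                 ≡⟨ cong _* (L.[]≡sub₀ t u) ⟩
    sub (L.sub₀ u) t *          ≈⟨ back-sub (L.sub₀ u) (sub₀ (u *)) (λ { zero → ε ; (suc i) → ε }) t ⟩
    sub (sub₀ (u *)) (t *)      ≡⟨ []≡sub₀ (t *) (u *) ⟨
    t * [ u * ]                 ∎
    where open ≡β-Reasoning

  back-⟶λΠ : ∀ {n} {C D : LTm P n} → C ⟶λΠ D → C * ≡β D *
  back-⟶λΠ (root (by-β (beta A t u)))  = ⟶β⇒≡β (root (beta _ _ _)) ◅◅ ≡β-sym (back-[] t u)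
  back-⟶λΠ (root (by-rw (rw-ax a)))    = ε
  back-⟶λΠ (root (by-rw (rw-pi r X Y))) = ≡β-pi ε (≡β-sym (begin
    backApp s₀ (wk Y) (var zero)   ≈⟨ backApp-≡β (wk Y) (var zero) ⟩
    app (wk Y *) (var zero)        ≈⟨ ≡β-app (back-ren suc Y) ε ⟩
    app (wk (Y *)) (var zero)      ∎))
    where open ≡β-Reasoning
  back-⟶λΠ (piˡ p)  = ≡β-pi (back-⟶λΠ p) ε
  back-⟶λΠ (piʳ p)  = ≡β-pi ε (back-⟶λΠ p)
  back-⟶λΠ (lamˡ p) = ≡β-lam (back-⟶λΠ p) ε
  back-⟶λΠ (lamʳ p) = ≡β-lam ε (back-⟶λΠ p)
  back-⟶λΠ (appˡ {t} {t'} {u} p) =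
    backApp-≡β t u ◅◅ ≡β-app (back-⟶λΠ p) ε ◅◅ ≡β-sym (backApp-≡β t' u)
  back-⟶λΠ (appʳ {t} {u} {u'} p) =
    backApp-≡β t u ◅◅ ≡β-app ε (back-⟶λΠ p) ◅◅ ≡β-sym (backApp-≡β t u')

  back-≡λΠ : ∀ {n} {C D : LTm P n} → C ≡λΠ D → C * ≡β D *
  back-≡λΠ = EqClosure.gfold (EqClosure.isEquivalence _⟶β_) _* back-⟶λΠ

  back-Tr : ∀ {n} {Γ : Ctx P n} {A a} → Tr Γ A a → a * ≡β A
  back-Tr (tr-var i)  = ε
  back-Tr (tr-sort a) = ε
  back-Tr (tr-pi {b = b} r _ _ _ trA trB) =
    ≡β-pi (back-Tr trA) (⟶β⇒≡β (root (beta _ _ _)) ◅◅ ≡⇒≡β (ren-ext-suc-[var-zero] (b *)) ◅◅ back-Tr trB)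
  back-Tr (tr-lam _ trA trt) = ≡β-lam (back-Tr trA) (back-Tr trt)
  back-Tr (tr-app {a = a} {b} trt tru) = backApp-≡β a b ◅◅ ≡β-app (back-Tr trt) (back-Tr tru)

  back-Norm : ∀ {n} {Γ : Ctx P n} {A X} → Norm Γ A X → X * ≡β A
  back-Norm (norm-typed _ tr) = back-Tr tr
  back-Norm (norm-top _)      = ε

  Norm-≡λΠ⇒≡β : ∀ {n} (Γ : Ctx P n) (A B : PTm P n) (X Y : LTm P n) →
                Norm Γ A X → Norm Γ B Y → X ≡λΠ Y → A ≡β B
  Norm-≡λΠ⇒≡β Γ A B X Y normX normY X≡Y = ≡β-sym (back-Norm normX) ◅◅ back-≡λΠ X≡Y ◅◅ back-Norm normY

proposition13 : (P : PTS) → IsFunctional P → (s₀ : PTS.Sort P) →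
    (∀ {n} (Γ : Ctx P n) (A B : PTm P n) (X Y : LTm P n) →
       Norm Γ A X → Norm Γ B Y → A ≡β B → X ≡λΠ Y)
  × (∀ {n} (C D : LTm P n) → C ≡λΠ D → back s₀ C ≡β back s₀ D)
  × (∀ {n} (Γ : Ctx P n) (A B : PTm P n) (X Y : LTm P n) →
       Norm Γ A X → Norm Γ B Y → X ≡λΠ Y → A ≡β B)
proposition13 P functional s₀ =
  NormConversion.Norm-≡β⇒≡λΠ P functional ,
  (λ C D → BackTranslation.back-≡λΠ P s₀) ,
  BackTranslation.Norm-≡λΠ⇒≡β P s₀
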